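{- For every abstraction $\lambda x.M \in \Lambda^\bullet$ and every $N \in \Lambda^\bullet$, we have $\mathrm{RB}((\lambda x.M)\ N) \rightarrow \mathrm{RB}(M[x:=N])$, where $\rightarrow$ denotes one-step $\beta$-reduction on $\lambda$-terms.
   Context: $\Lambda$ is the set of untyped $\lambda$-terms; $\rightarrow$ on $\Lambda$ is one-step $\beta$-reduction and $\equiv$ is syntactic identity. For every $\lambda$-term $M$ there is a new constant symbol $\underline{M}$, called an atom; atoms have no free variables ($\mathrm{FV}(\underline{x})=\varnothing$) and substitution leaves an atom unchanged. Terms may be built from variables, atoms, application and abstraction, with substitution $M[x:=N]$ and free variables extended accordingly. For $M \in \Lambda$, $M^\bullet$ is the result of replacing each free variable $x$ of $M$ in $M$ by the atom $\underline{x}$, and $\Lambda^\bullet = \{M^\bullet \mid M \in \Lambda\}$ (so every element of $\Lambda^\bullet$ has no free variables, and an abstraction $\lambda x.M \in \Lambda^\bullet$ may have $x$ free in its body $M$). The read-back $\mathrm{RB}$ is defined on $\Lambda^\bullet$ by: $\mathrm{RB}(M\ N) \equiv \mathrm{RB}(M)\ \mathrm{RB}(N)$ for $M,N\in\Lambda^\bullet$; $\mathrm{RB}(\lambda x.M) \equiv \lambda x.\mathrm{RB}(M[x:=\underline{x}])$ for $\lambda x.M \in \Lambda^\bullet$; $\mathrm{RB}(\underline{M}) \equiv M$ for $M \in \Lambda$. -}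

module Defs where

open import Data.Nat using (ℕ; zero; suc; _+_; _≡ᵇ_)
open import Data.Bool using (Bool; true; false; if_then_else_; _∨_)
open import Data.List using (List; []; _∷_)
open import Data.Product using (∃)
open import Relation.Binary.PropositionalEquality using (_≡_)

Var : Set
Var = ℕ

-- Λ : raw untyped λ-terms (≡ is syntactic identity, no α-quotient).
data Λ : Set where
  var : Var → Λ
  app : Λ → Λ → Λ
  lam : Var → Λ → Λ

_[_≔_] : Λ → Var → Λ → Λ
var y   [ x ≔ N ] = if x ≡ᵇ y then N else var y
app P Q [ x ≔ N ] = app (P [ x ≔ N ]) (Q [ x ≔ N ])
lam y P [ x ≔ N ] = if x ≡ᵇ y then lam y P else lam y (P [ x ≔ N ])

infix 4 _⟶_
data _⟶_ : Λ → Λ → Set where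
  β    : ∀ {x M N} → app (lam x M) N ⟶ M [ x ≔ N ]
  appL : ∀ {M M' N} → M ⟶ M' → app M N ⟶ app M' N
  appR : ∀ {M N N'} → N ⟶ N' → app M N ⟶ app M N'
  ξ    : ∀ {x M M'} → M ⟶ M' → lam x M ⟶ lam x M'

-- Terms extended with atoms: one constant  atom M  (written M underlined) per M ∈ Λ.
data Tm : Set where
  var  : Var → Tm
  atom : Λ → Tm
  app  : Tm → Tm → Tm
  lam  : Var → Tm → Tm

_[_≔_]ᵗ : Tm → Var → Tm → Tm
var y   [ x ≔ N ]ᵗ = if x ≡ᵇ y then N else var y
atom A  [ x ≔ N ]ᵗ = atom A
app P Q [ x ≔ N ]ᵗ = app (P [ x ≔ N ]ᵗ) (Q [ x ≔ N ]ᵗ)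
lam y P [ x ≔ N ]ᵗ = if x ≡ᵇ y then lam y P else lam y (P [ x ≔ N ]ᵗ)

_∈ᵇ_ : Var → List Var → Bool
x ∈ᵇ []       = false
x ∈ᵇ (y ∷ ys) = (x ≡ᵇ y) ∨ (x ∈ᵇ ys)

-- M• : replace every free occurrence of a variable x by the atom x̲.
bulletUnder : List Var → Λ → Tm
bulletUnder bs (var y)   = if y ∈ᵇ bs then var y else atom (var y)
bulletUnder bs (app P Q) = app (bulletUnder bs P) (bulletUnder bs Q)
bulletUnder bs (lam y P) = lam y (bulletUnder (y ∷ bs) P)

_• : Λ → Tm
M • = bulletUnder [] M

InΛ• : Tm → Set
InΛ• T = ∃ λ (M : Λ) → M • ≡ T

size : Tm → ℕ
size (var _)   = 1
size (atom _)  = 1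
size (app P Q) = suc (size P + size Q)
size (lam _ P) = suc (size P)

-- Read-back, with the paper's clauses; fuel only ensures termination
-- (substituting an atom for a variable preserves size, so fuel = size suffices).
-- The var-clause and the out-of-fuel clause are junk values, never reached on Λ•.
RBf : ℕ → Tm → Λ
RBf zero    _         = var 0
RBf (suc n) (var y)   = var y
RBf (suc n) (atom M)  = M
RBf (suc n) (app P Q) = app (RBf n P) (RBf n Q)
RBf (suc n) (lam x P) = lam x (RBf n (P [ x ≔ atom (var x) ]ᵗ))

RB : Tm → Λ
RB T = RBf (size T) T

module Submission where

open import Defs
open import Data.Nat using (suc; _+_; _≡ᵇ_; _≤_; s≤s)
open import Data.Nat.Properties using (≤-refl; ≤-trans; m≤m+n; m≤n+m; ≡ᵇ⇒≡; ≡⇒≡ᵇ)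
open import Data.Bool using (true; false; _∨_)
open import Data.Bool.Properties using (T-≡; ∨-zeroʳ)
open import Data.List using ([]; _∷_)
open import Data.Product using (_,_)
open import Function.Bundles using (Equivalence)
open import Relation.Binary.PropositionalEquality

-- RB reads an atom x̲ back as x, and reads a binder λx back by first turning its x into x̲;
-- so on every term RB is just the map  erase  replacing each atom by its underlying λ-term.
-- In M• the variable bound by λx is still a variable, not an atom, so erasure commutes with
-- substituting for it, and RB((λx.M) N) = (λx.erase M) (erase N) contracts to erase (M[x:=N]).

erase : Tm → Λ
erase (var y)   = var y
erase (atom A)  = A
erase (app P Q) = app (erase P) (erase Q)
erase (lam y P) = lam y (erase P)

≡ᵇ-true⇒≡ : ∀ {x y} → (x ≡ᵇ y) ≡ true → x ≡ y
≡ᵇ-true⇒≡ {x} {y} eq = ≡ᵇ⇒≡ x y (Equivalence.from T-≡ eq)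

∈ᵇ-here : ∀ x bs → (x ∈ᵇ (x ∷ bs)) ≡ true
∈ᵇ-here x bs = cong (_∨ (x ∈ᵇ bs)) (Equivalence.to T-≡ (≡⇒≡ᵇ x x refl))

∈ᵇ-there : ∀ x y bs → (x ∈ᵇ bs) ≡ true → (x ∈ᵇ (y ∷ bs)) ≡ true
∈ᵇ-there x y bs x∈bs = trans (cong ((x ≡ᵇ y) ∨_) x∈bs) (∨-zeroʳ (x ≡ᵇ y))

size-[≔atom] : ∀ T x A → size (T [ x ≔ atom A ]ᵗ) ≡ size T
size-[≔atom] (var y) x A with x ≡ᵇ y
... | true  = refl
... | false = refl
size-[≔atom] (atom B) x A = refl
size-[≔atom] (app P Q) x A =
  cong₂ (λ m n → suc (m + n)) (size-[≔atom] P x A) (size-[≔atom] Q x A)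
size-[≔atom] (lam y P) x A with x ≡ᵇ y
... | true  = refl
... | false = cong suc (size-[≔atom] P x A)

erase-[≔atom-var] : ∀ T x → erase (T [ x ≔ atom (var x) ]ᵗ) ≡ erase T
erase-[≔atom-var] (var y) x with x ≡ᵇ y in x≟y
... | true  = cong var (≡ᵇ-true⇒≡ x≟y)
... | false = refl
erase-[≔atom-var] (atom B) x = refl
erase-[≔atom-var] (app P Q) x = cong₂ app (erase-[≔atom-var] P x) (erase-[≔atom-var] Q x)
erase-[≔atom-var] (lam y P) x with x ≡ᵇ y
... | true  = refl
... | false = cong (lam y) (erase-[≔atom-var] P x)

RBf≡erase : ∀ n T → size T ≤ n → RBf n T ≡ erase T
RBf≡erase (suc n) (var y)   _ = refl
RBf≡erase (suc n) (atom A)  _ = refl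
RBf≡erase (suc n) (app P Q) (s≤s size≤n) =
  cong₂ app (RBf≡erase n P (≤-trans (m≤m+n _ _) size≤n))
            (RBf≡erase n Q (≤-trans (m≤n+m _ _) size≤n))
RBf≡erase (suc n) (lam x P) (s≤s size≤n) = cong (lam x) (begin
  RBf n (P [ x ≔ atom (var x) ]ᵗ)
    ≡⟨ RBf≡erase n _ (subst (_≤ n) (sym (size-[≔atom] P x (var x))) size≤n) ⟩
  erase (P [ x ≔ atom (var x) ]ᵗ)  ≡⟨ erase-[≔atom-var] P x ⟩
  erase P                          ∎)
  where open ≡-Reasoning

RB≡erase : ∀ T → RB T ≡ erase T
RB≡erase T = RBf≡erase (size T) T ≤-refl

-- The hypothesis x ∈ bs is needed: an atom x̲ (from a free x) erases to x but is not substituted.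
erase-bulletUnder-[≔] : ∀ bs P x N → (x ∈ᵇ bs) ≡ true →
  erase (bulletUnder bs P [ x ≔ N ]ᵗ) ≡ erase (bulletUnder bs P) [ x ≔ erase N ]
erase-bulletUnder-[≔] bs (var y) x N x∈bs with y ∈ᵇ bs in y∈?bs
... | true with x ≡ᵇ y
...   | true  = refl
...   | false = refl
erase-bulletUnder-[≔] bs (var y) x N x∈bs | false with x ≡ᵇ y in x≟y
...   | false = refl
...   | true with refl ← ≡ᵇ-true⇒≡ {x} {y} x≟y with () ← trans (sym x∈bs) y∈?bs
erase-bulletUnder-[≔] bs (app P Q) x N x∈bs =
  cong₂ app (erase-bulletUnder-[≔] bs P x N x∈bs) (erase-bulletUnder-[≔] bs Q x N x∈bs)
erase-bulletUnder-[≔] bs (lam y P) x N x∈bs with x ≡ᵇ y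
... | true  = refl
... | false = cong (lam y) (erase-bulletUnder-[≔] (y ∷ bs) P x N (∈ᵇ-there x y bs x∈bs))

proposition1 : (x : Var) (M N : Tm) → InΛ• (lam x M) → InΛ• N →
    RB (app (lam x M) N) ⟶ RB (M [ x ≔ N ]ᵗ)
proposition1 x M N (lam .x P , refl) _ =
  subst₂ _⟶_ (sym (RB≡erase (app (lam x M) N))) (sym RB[M[x≔N]]) β
  where
  RB[M[x≔N]] : RB (M [ x ≔ N ]ᵗ) ≡ erase M [ x ≔ erase N ]
  RB[M[x≔N]] = trans (RB≡erase (M [ x ≔ N ]ᵗ)) (erase-bulletUnder-[≔] (x ∷ []) P x N (∈ᵇ-here x []))
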